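{- Let $n\ge 2$ targets $\mathcal T=\{1,\dots,n\}$ be given with travel times $c(u,v)>0$ ($u\ne v$) satisfying the triangle inequality. Then $\mathcal R^*(n)=TSP^*$, and $\mathcal R^*(k)\ge \mathcal R^*(n)=TSP^*$ for every integer $k\ge n$.
   Context: Targets $\mathcal T=\{1,\dots,n\}$, $n\ge 2$; travel times $c(u,v)>0$ for distinct $u,v\in\mathcal T$ (set $c(u,u)=0$), satisfying $c(u,v)+c(v,w)\ge c(u,w)$ for all $u,v,w\in\mathcal T$. $TSP^*$ denotes the minimum, over all orderings $(u_1,\dots,u_n)$ of $\mathcal T$, of $\sum_{i=1}^{n-1}c(u_i,u_{i+1})+c(u_n,u_1)$ (the cost of an optimal traveling salesman tour). For an integer $k\ge n$, a closed walk with $k$ visits is a sequence $\mathcal W=(v_1,\dots,v_{k+1})$ of targets with $v_{k+1}=v_1$, $v_i\ne v_{i+1}$ for $1\le i\le k$, and every target appearing among $v_1,\dots,v_k$. The walk is repeated forever: extend it to the infinite periodic sequence $(v_i)_{i\ge 1}$ with $v_{i+k}=v_i$, where moving from $v_i$ to $v_{i+1}$ takes time $c(v_i,v_{i+1})$. For a target $d$, the revisit time $RT(d,\mathcal W)$ is the maximum, over all pairs of indices $i<j$ with $v_i=v_j=d$ and $v_l\ne d$ for $i<l<j$, of $\sum_{l=i}^{j-1}c(v_l,v_{l+1})$. The revisit time of the walk is $\mathcal R(\mathcal W)=\max_{d\in\mathcal T}RT(d,\mathcal W)$, and $\mathcal R^*(k)$ is the minimum of $\mathcal R(\mathcal W)$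 over all closed walks with $k$ visits (with the convention $\mathcal R^*(k)=+\infty$ if no such walk exists).
   Formalization: The travel times $c(u,v)$ take rational values. -}

module Defs where

open import Data.Nat using (ℕ; zero; suc; NonZero; _∸_) renaming (_<_ to _<ℕ_)
open import Data.Nat.DivMod using (_%_; m%n<n)
open import Data.Fin using (Fin; fromℕ<; toℕ)
open import Data.Fin.Permutation using (Permutation′; _⟨$⟩ʳ_)
open import Data.Rational using (ℚ; 0ℚ; _+_; _≤_)
open import Data.Product using (Σ; ∃; _×_)
open import Relation.Binary.PropositionalEquality using (_≡_; _≢_)

Cost : ℕ → Set
Cost n = Fin n → Fin n → ℚ

ext : ∀ {n k} .{{_ : NonZero k}} → (Fin k → Fin n) → ℕ → Fin n
ext {k = k} w i = w (fromℕ< (m%n<n i k))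

pathCost : ∀ {n} → Cost n → (ℕ → Fin n) → ℕ → ℕ → ℚ
pathCost c v i zero    = 0ℚ
pathCost c v i (suc m) = c (v i) (v (suc i)) + pathCost c v (suc i) m

-- cost of the closed tour through the ordering π(0), …, π(n-1), back to π(0)
tourCost : ∀ {n} .{{_ : NonZero n}} → Cost n → Permutation′ n → ℚ
tourCost {n} c π = pathCost c (ext (π ⟨$⟩ʳ_)) 0 n

IsTSPOpt : ∀ {n} → Cost n → ℚ → Set
IsTSPOpt {n} c t = ∀ {{_ : NonZero n}} →
  (∃ λ π → tourCost c π ≡ t) × (∀ π → t ≤ tourCost c π)

IsClosedWalk : ∀ {n k} .{{_ : NonZero k}} → (Fin k → Fin n) → Set
IsClosedWalk {n} {k} w =
  (∀ (i : Fin k) → ext w (toℕ i) ≢ ext w (suc (toℕ i))) ×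
  (∀ (d : Fin n) → ∃ λ i → w i ≡ d)

ConsecVisits : ∀ {n} → (ℕ → Fin n) → Fin n → ℕ → ℕ → Set
ConsecVisits v d i j =
  i <ℕ j × v i ≡ d × v j ≡ d × (∀ l → i <ℕ l → l <ℕ j → v l ≢ d)

-- r = R(W) = max over targets d of RT(d,W), i.e. max over all d and all
-- consecutive visits i<j of d of the travel time from v_i to v_j
IsRevisitTime : ∀ {n k} .{{_ : NonZero k}} → Cost n → (Fin k → Fin n) → ℚ → Set
IsRevisitTime c w r =
  (Σ _ λ d → Σ ℕ λ i → Σ ℕ λ j → ConsecVisits (ext w) d i j × pathCost c (ext w) i (j ∸ i) ≡ r) ×
  (∀ d i j → ConsecVisits (ext w) d i j → pathCost c (ext w) i (j ∸ i) ≤ r)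

IsRStar : ∀ {n} → Cost n → (k : ℕ) → ℚ → Set
IsRStar {n} c k r = ∀ {{_ : NonZero k}} →
  (Σ (Fin k → Fin n) λ w → IsClosedWalk w × IsRevisitTime c w r) ×
  (∀ (w : Fin k → Fin n) → IsClosedWalk w → ∀ r′ → IsRevisitTime c w r′ → r ≤ r′)

{-# OPTIONS --safe #-}
-- A walk repeating an optimal tour visits every target once per period, so
-- each revisit takes exactly one tour: R*(n) ≤ TSP*. Conversely, in a closed
-- walk with period k let j be the first time by which every target has been
-- visited during [k, j], d = v_j, and i the previous visit of d. As d is new
-- at j, i < k, so every other target is visited strictly between i and j;
-- shortcutting repeated targets on the closed walk v_i … v_j (triangle
-- inequality) leaves a Hamiltonian tour, whence TSP* ≤ RT(d) ≤ R(W).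
module Submission where

open import Defs
open import Data.Nat
  using (ℕ; zero; suc; NonZero; _∸_; _≤?_; z≤n; s≤s; s≤s⁻¹; z<s; >-nonZero⁻¹)
  renaming (_≤_ to _≤ℕ_; _<_ to _<ℕ_; _+_ to _+ℕ_)
import Data.Nat.Properties as ℕ
open import Data.Nat.DivMod using (_%_; m%n<n; [m+n]%n≡m%n; m<n⇒m%n≡m; n%n≡0)
open import Data.Fin using (Fin; zero; suc; toℕ; fromℕ<; cast) renaming (_≟_ to _≟ᶠ_)
open import Data.Fin.Properties
  using (toℕ<n; fromℕ<-toℕ; fromℕ<-cong; fromℕ<-injective; cast-is-id)
open import Data.Fin.Permutation
  using (Permutation; Permutation′; permutation; _⟨$⟩ʳ_; _⟨$⟩ˡ_; inverseʳ; _∘ₚ_; cast-id; ↔⇒≡)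
open import Data.Rational using (ℚ; 0ℚ; _+_; _≤_; _<_)
import Data.Rational.Properties as ℚ
open import Data.List using (List; []; _∷_; _++_; [_]; length; lookup; tabulate; deduplicate)
open import Data.List.Properties using (tabulate-cong; tabulate-lookup)
open import Data.List.Membership.Propositional using (_∈_)
open import Data.List.Membership.Propositional.Properties
  using (∈-lookup; ∈-deduplicate⁻; ∈-deduplicate⁺)
open import Data.List.Relation.Unary.Any using (here; there; index)
open import Data.List.Relation.Unary.Any.Properties using (lookup-index)
import Data.List.Relation.Unary.All as All
open import Data.List.Relation.Unary.All.Properties using (¬Any⇒All¬)
open import Data.List.Relation.Unary.Unique.Propositional using (Unique; _∷_)
import Data.List.Relation.Unary.Unique.DecPropositional.Properties as UniqueDec
open import Data.List.Relation.Binary.Sublist.Propositional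
  using (_⊆_; []; _∷_; _∷ʳ_; ⊆-trans)
open import Data.List.Relation.Binary.Sublist.Propositional.Properties using (filter-⊆)
open import Data.Product using (Σ; ∃; ∃₂; _×_; _,_; proj₁; proj₂)
open import Data.Sum using (_⊎_; inj₁; inj₂)
import Data.Sum as Sum
open import Data.Empty using (⊥-elim)
open import Function using (_∘_; id)
open import Function.Bundles using (Injection)
open import Function.Properties.Inverse using (↔⇒↣)
open import Relation.Binary.Definitions using (DecidableEquality)
open import Relation.Nullary using (¬_; Dec; yes; no; ¬?)
open import Relation.Nullary.Decidable using (_×-dec_)
open import Relation.Binary.PropositionalEquality
  using (_≡_; _≢_; refl; sym; trans; cong; cong₂; subst; module ≡-Reasoning)

Triangle : {A : Set} → (A → A → ℚ) → Set
Triangle c = ∀ u v w → c u w ≤ c u v + c v w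

module _ {A : Set} (c : A → A → ℚ) where

  walkCost : A → List A → ℚ
  walkCost a []       = 0ℚ
  walkCost a (x ∷ xs) = c a x + walkCost x xs

  cycleCost : List A → ℚ
  cycleCost []       = 0ℚ
  cycleCost (x ∷ xs) = walkCost x (xs ++ [ x ])

  module _ (triangle : Triangle c) where
    open ℚ.≤-Reasoning

    private
      detour : ∀ a x y r → c a y + r ≤ c a x + (c x y + r)
      detour a x y r = begin
        c a y + r             ≤⟨ ℚ.+-monoˡ-≤ r (triangle a x y) ⟩
        (c a x + c x y) + r   ≡⟨ ℚ.+-assoc (c a x) (c x y) r ⟩
        c a x + (c x y + r)   ∎

    walkCost-detour : ∀ a x ys b → walkCost a (ys ++ [ b ]) ≤ c a x + walkCost x (ys ++ [ b ])
    walkCost-detour a x []       b = detour a x b 0ℚ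
    walkCost-detour a x (y ∷ ys) b = detour a x y (walkCost y (ys ++ [ b ]))

    walkCost-shortcut : ∀ {ys xs} a b → ys ⊆ xs → walkCost a (ys ++ [ b ]) ≤ walkCost a (xs ++ [ b ])
    walkCost-shortcut a b [] = ℚ.≤-refl
    walkCost-shortcut {ys} {x ∷ xs} a b (.x ∷ʳ ys⊆xs) = begin
      walkCost a (ys ++ [ b ])         ≤⟨ walkCost-detour a x ys b ⟩
      c a x + walkCost x (ys ++ [ b ]) ≤⟨ ℚ.+-monoʳ-≤ (c a x) (walkCost-shortcut x b ys⊆xs) ⟩
      c a x + walkCost x (xs ++ [ b ]) ∎
    walkCost-shortcut a b (refl ∷ ys⊆xs) = ℚ.+-monoʳ-≤ (c a _) (walkCost-shortcut _ b ys⊆xs)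

deduplicate-⊆ : {A : Set} (_≟_ : DecidableEquality A) (xs : List A) → deduplicate _≟_ xs ⊆ xs
deduplicate-⊆ _≟_ []       = []
deduplicate-⊆ _≟_ (x ∷ xs) =
  refl ∷ ⊆-trans (filter-⊆ (¬? ∘ (x ≟_)) (deduplicate _≟_ xs)) (deduplicate-⊆ _≟_ xs)

trace : {A : Set} → (ℕ → A) → ℕ → ℕ → List A
trace v i zero    = []
trace v i (suc m) = v (suc i) ∷ trace v (suc i) m

VisitedIn : {A : Set} → (ℕ → A) → ℕ → ℕ → A → Set
VisitedIn v lo hi t = ∃ λ p → p <ℕ hi × lo ≤ℕ p × v p ≡ t

module _ {A : Set} (v : ℕ → A) where

  trace-∷ʳ : ∀ i m → trace v i (suc m) ≡ trace v i m ++ [ v (suc (i +ℕ m)) ]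
  trace-∷ʳ i zero    = cong (λ p → [ v (suc p) ]) (sym (ℕ.+-identityʳ i))
  trace-∷ʳ i (suc m) = cong (v (suc i) ∷_)
    (trans (trace-∷ʳ (suc i) m) (cong (λ p → trace v (suc i) m ++ [ v (suc p) ]) (sym (ℕ.+-suc i m))))

  trace≡tabulate : ∀ i m → trace v i m ≡ tabulate {n = m} (λ k → v (suc (i +ℕ toℕ k)))
  trace≡tabulate i zero    = refl
  trace≡tabulate i (suc m) = cong₂ _∷_ (cong (v ∘ suc) (sym (ℕ.+-identityʳ i)))
    (trans (trace≡tabulate (suc i) m) (tabulate-cong (λ k → cong (v ∘ suc) (sym (ℕ.+-suc i (toℕ k))))))

  VisitedIn-weakenˡ : ∀ {lo′ lo hi t} → lo′ ≤ℕ lo → VisitedIn v lo hi t → VisitedIn v lo′ hi t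
  VisitedIn-weakenˡ lo′≤lo (p , p<hi , lo≤p , e) = p , p<hi , ℕ.≤-trans lo′≤lo lo≤p , e

  VisitedIn-last : ∀ {lo hi t} → VisitedIn v lo (suc hi) t → t ≡ v hi ⊎ VisitedIn v lo hi t
  VisitedIn-last (p , p<1+hi , lo≤p , e) with ℕ.m<1+n⇒m<n∨m≡n p<1+hi
  ... | inj₁ p<hi = inj₂ (p , p<hi , lo≤p , e)
  ... | inj₂ refl = inj₁ (sym e)

  VisitedIn-shift : ∀ {k} → (∀ p → v (p +ℕ k) ≡ v p) →
                    ∀ {lo hi t} → VisitedIn v lo hi t → VisitedIn v (lo +ℕ k) (hi +ℕ k) t
  VisitedIn-shift {k} periodic (p , p<hi , lo≤p , e) =
    p +ℕ k , ℕ.+-monoˡ-< k p<hi , ℕ.+-monoˡ-≤ k lo≤p , trans (periodic p) e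

  ∈-trace⁻ : ∀ {t} i m → t ∈ trace v i m → VisitedIn v (suc i) (suc (i +ℕ m)) t
  ∈-trace⁻ i (suc m) (here t≡v)  = suc i , s≤s (ℕ.m<m+n i z<s) , ℕ.≤-refl , sym t≡v
  ∈-trace⁻ i (suc m) (there t∈) with ∈-trace⁻ (suc i) m t∈
  ... | p , p< , i<p , e = p , subst (p <ℕ_) (cong suc (sym (ℕ.+-suc i m))) p< , ℕ.<⇒≤ i<p , e

  ∈-trace⁺ : ∀ {t} i m → VisitedIn v (suc i) (suc (i +ℕ m)) t → t ∈ trace v i m
  ∈-trace⁺ i zero (p , s≤s p≤i+0 , i<p , _) =
    ⊥-elim (ℕ.<⇒≱ i<p (subst (p ≤ℕ_) (ℕ.+-identityʳ i) p≤i+0))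
  ∈-trace⁺ i (suc m) (p , p< , i<p , e) with ℕ.m≤n⇒m<n∨m≡n i<p
  ... | inj₂ refl  = here (sym e)
  ... | inj₁ 1+i<p =
    there (∈-trace⁺ (suc i) m (p , subst (p <ℕ_) (cong suc (ℕ.+-suc i m)) p< , 1+i<p , e))

module _ {n} (c : Cost n) where

  pathCost≡walkCost : ∀ v i m → pathCost c v i m ≡ walkCost c (v i) (trace v i m)
  pathCost≡walkCost v i zero    = refl
  pathCost≡walkCost v i (suc m) = cong (c (v i) (v (suc i)) +_) (pathCost≡walkCost v (suc i) m)

  pathCost-∷ʳ : ∀ v i m → pathCost c v i (suc m) ≡ pathCost c v i m + c (v (i +ℕ m)) (v (suc (i +ℕ m)))
  pathCost-∷ʳ v i zero rewrite ℕ.+-identityʳ i =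
    trans (ℚ.+-identityʳ (c (v i) (v (suc i)))) (sym (ℚ.+-identityˡ (c (v i) (v (suc i)))))
  pathCost-∷ʳ v i (suc m) rewrite pathCost-∷ʳ v (suc i) m | ℕ.+-suc i m =
    sym (ℚ.+-assoc (c (v i) (v (suc i))) (pathCost c v (suc i) m) _)

  module _ {v : ℕ → Fin n} where
    open ≡-Reasoning

    pathCost-shift : ∀ m → (∀ p → v (p +ℕ m) ≡ v p) → ∀ i → pathCost c v (suc i) m ≡ pathCost c v i m
    pathCost-shift zero    _        i = refl
    pathCost-shift (suc m) periodic i = begin
      pathCost c v (suc i) (suc m)                      ≡⟨ pathCost-∷ʳ v (suc i) m ⟩
      rest + c (v (suc i +ℕ m)) (v (suc (suc i +ℕ m))) ≡⟨ cong₂ (λ x y → rest + c x y) (periodic′ i) (periodic′ (suc i)) ⟩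
      rest + c (v i) (v (suc i))                        ≡⟨ ℚ.+-comm rest _ ⟩
      pathCost c v i (suc m)                            ∎
      where
        rest : ℚ
        rest = pathCost c v (suc i) m
        periodic′ : ∀ p → v (suc p +ℕ m) ≡ v p
        periodic′ p = trans (cong v (sym (ℕ.+-suc p m))) (periodic p)

    pathCost-rotate : ∀ {m} → (∀ p → v (p +ℕ m) ≡ v p) → ∀ i → pathCost c v i m ≡ pathCost c v 0 m
    pathCost-rotate periodic zero    = refl
    pathCost-rotate periodic (suc i) = trans (pathCost-shift _ periodic i) (pathCost-rotate periodic i)

  module _ (nonneg : ∀ u w → 0ℚ ≤ c u w) (v : ℕ → Fin n) where

    pathCost-nonneg : ∀ i m → 0ℚ ≤ pathCost c v i m
    pathCost-nonneg i zero    = ℚ.≤-refl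
    pathCost-nonneg i (suc m) = ℚ.+-mono-≤ (nonneg _ _) (pathCost-nonneg (suc i) m)

    pathCost-monoˡ : ∀ i {m m′} → m ≤ℕ m′ → pathCost c v i m ≤ pathCost c v i m′
    pathCost-monoˡ i {m′ = m′} z≤n = pathCost-nonneg i m′
    pathCost-monoˡ i (s≤s m≤m′)    = ℚ.+-monoʳ-≤ (c (v i) (v (suc i))) (pathCost-monoˡ (suc i) m≤m′)

module _ {n} (v : ℕ → Fin n) where

  visitedIn? : ∀ lo hi t → Dec (VisitedIn v lo hi t)
  visitedIn? lo hi t = ℕ.anyUpTo? (λ p → (lo ≤? p) ×-dec (v p ≟ᶠ t)) hi

  firstCompletion : ∀ lo hi → (∀ t → VisitedIn v lo hi t) →
                    ∃ λ j → lo ≤ℕ j × (∀ t → VisitedIn v lo (suc j) t) × ¬ VisitedIn v lo j (v j)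
  firstCompletion lo zero complete with complete (v 0)
  ... | _ , () , _
  firstCompletion lo (suc hi) complete with visitedIn? lo hi (v hi)
  ... | yes seen = firstCompletion lo hi λ t → Sum.[ (λ t≡vhi → subst (VisitedIn v lo hi) (sym t≡vhi) seen) , id ]
                                                    (VisitedIn-last v (complete t))
  ... | no fresh = hi , lo≤hi , complete , fresh
    where
      lo≤hi : lo ≤ℕ hi
      lo≤hi with complete (v hi)
      ... | _ , p<1+hi , lo≤p , _ = ℕ.≤-trans lo≤p (s≤s⁻¹ p<1+hi)

  lastVisitBefore : ∀ {d q} j → q <ℕ j → v q ≡ d →
                    ∃ λ i → i <ℕ j × v i ≡ d × (∀ l → i <ℕ l → l <ℕ j → v l ≢ d)
  lastVisitBefore {d} (suc j) (s≤s q≤j) vq≡d with v j ≟ᶠ d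
  ... | yes vj≡d = j , ℕ.≤-refl , vj≡d , λ l j<l l<1+j → ⊥-elim (ℕ.<⇒≱ j<l (s≤s⁻¹ l<1+j))
  ... | no vj≢d with ℕ.m≤n⇒m<n∨m≡n q≤j
  ...   | inj₂ refl = ⊥-elim (vj≢d vq≡d)
  ...   | inj₁ q<j with lastVisitBefore j q<j vq≡d
  ...     | i , i<j , vi≡d , gap = i , ℕ.m<n⇒m<1+n i<j , vi≡d , gap′
    where
      gap′ : ∀ l → i <ℕ l → l <ℕ suc j → v l ≢ d
      gap′ l i<l l<1+j with ℕ.m<1+n⇒m<n∨m≡n l<1+j
      ... | inj₁ l<j  = gap l i<l l<j
      ... | inj₂ refl = vj≢d

  returnVisitingAll : ∀ lo hi → (∀ t → VisitedIn v 0 lo t) → (∀ t → VisitedIn v lo hi t) →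
                      ∃₂ λ d i → ∃ λ j → ConsecVisits v d i j × (∀ t → t ≡ d ⊎ VisitedIn v (suc i) j t)
  returnVisitingAll lo hi before complete with firstCompletion lo hi complete
  ... | j , lo≤j , completeⱼ , fresh with before (v j)
  ...   | q , q<lo , _ , vq≡vj with lastVisitBefore j (ℕ.<-≤-trans q<lo lo≤j) vq≡vj
  ...     | i , i<j , vi≡vj , gap =
    v j , i , j , (i<j , vi≡vj , refl , gap) ,
    λ t → Sum.map₂ (VisitedIn-weakenˡ v i<lo) (VisitedIn-last v (completeⱼ t))
    where
      i<lo : i <ℕ lo
      i<lo = ℕ.≰⇒> λ lo≤i → fresh (i , i<j , lo≤i , vi≡vj)

  consecVisits-gap≤period : ∀ {d i j k} → 0 <ℕ k → (∀ p → v (p +ℕ k) ≡ v p) →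
                            ConsecVisits v d i j → j ∸ i ≤ℕ k
  consecVisits-gap≤period {i = i} {j} {k} 0<k periodic (_ , vi≡d , _ , gap) =
    ℕ.m≤n+o⇒m∸n≤o j i j≤i+k
    where
      j≤i+k : j ≤ℕ i +ℕ k
      j≤i+k = ℕ.≮⇒≥ λ i+k<j → gap (i +ℕ k) (ℕ.m<m+n i 0<k) i+k<j (trans (periodic i) vi≡d)

module _ {n k} .{{_ : NonZero k}} (w : Fin k → Fin n) where

  ext-toℕ : ∀ x → ext w (toℕ x) ≡ w x
  ext-toℕ x = cong w (trans (fromℕ<-cong _ _ (m<n⇒m%n≡m (toℕ<n x)) _ (toℕ<n x)) (fromℕ<-toℕ x (toℕ<n x)))

  ext-periodic : ∀ p → ext w (p +ℕ k) ≡ ext w p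
  ext-periodic p = cong w (fromℕ<-cong _ _ ([m+n]%n≡m%n p k) _ _)

  ext-injective-mod : (∀ {x y} → w x ≡ w y → x ≡ y) → ∀ {p q} → ext w p ≡ ext w q → p % k ≡ q % k
  ext-injective-mod injective {p} {q} e = fromℕ<-injective _ _ (m%n<n p k) (m%n<n q k) (injective e)

  ext-visitsAll : (∀ t → ∃ λ x → w x ≡ t) → ∀ t → VisitedIn (ext w) 0 k t
  ext-visitsAll onto t with onto t
  ... | x , wx≡t = toℕ x , toℕ<n x , z≤n , trans (ext-toℕ x) wx≡t

lookup-injective : {A : Set} {xs : List A} → Unique xs → ∀ {i j} → lookup xs i ≡ lookup xs j → i ≡ j
lookup-injective {xs = _ ∷ _} _ {zero} {zero} _ = refl
lookup-injective (x∉xs ∷ _) {zero} {suc j} x≡xⱼ = ⊥-elim (All.lookup x∉xs (∈-lookup j) x≡xⱼ)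
lookup-injective (x∉xs ∷ _) {suc i} {zero} xᵢ≡x = ⊥-elim (All.lookup x∉xs (∈-lookup i) (sym xᵢ≡x))
lookup-injective (_ ∷ unique) {suc i} {suc j} e = cong suc (lookup-injective unique e)

tabulate-lookup-cast : {A : Set} {m : ℕ} (xs : List A) (eq : m ≡ length xs) →
                       tabulate (lookup xs ∘ cast eq) ≡ xs
tabulate-lookup-cast xs refl =
  trans (tabulate-cong (cong (lookup xs) ∘ cast-is-id refl)) (tabulate-lookup xs)

module _ {n} {L : List (Fin n)} (unique : Unique L) (complete : ∀ t → t ∈ L) where

  lookupPermutation : Permutation (length L) n
  lookupPermutation = permutation (lookup L) (index ∘ complete)
    (λ t → sym (lookup-index (complete t)))
    (λ i → lookup-injective unique (sym (lookup-index (complete (lookup L i)))))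

  tabulatingPermutation : Σ (Permutation′ n) λ π → tabulate (π ⟨$⟩ʳ_) ≡ L
  tabulatingPermutation = cast-id n≡ℓ ∘ₚ lookupPermutation , tabulate-lookup-cast L n≡ℓ
    where
      n≡ℓ : n ≡ length L
      n≡ℓ = sym (↔⇒≡ lookupPermutation)

tourCost≡cycleCost : ∀ {n} .{{_ : NonZero n}} (c : Cost n) (π : Permutation′ n) →
                     tourCost c π ≡ cycleCost c (tabulate (π ⟨$⟩ʳ_))
tourCost≡cycleCost {suc n} c π = begin
  pathCost c v 0 (suc n)                                 ≡⟨ pathCost≡walkCost c v 0 (suc n) ⟩
  walkCost c (v 0) (trace v 0 (suc n))                   ≡⟨ cong (walkCost c (f zero)) (trace-∷ʳ v 0 n) ⟩
  walkCost c (f zero) (trace v 0 n ++ [ v (suc n) ])     ≡⟨ cong₂ (λ xs x → walkCost c (f zero) (xs ++ [ x ]))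
                                                                   trace≡ (ext-periodic f 0) ⟩
  walkCost c (f zero) (tabulate (f ∘ suc) ++ [ f zero ]) ∎
  where
    open ≡-Reasoning
    f : Fin (suc n) → Fin (suc n)
    f = π ⟨$⟩ʳ_
    v : ℕ → Fin (suc n)
    v = ext f
    trace≡ : trace v 0 n ≡ tabulate (f ∘ suc)
    trace≡ = trans (trace≡tabulate v 0 n) (tabulate-cong (ext-toℕ f ∘ suc))

module _ {n} {{_ : NonZero n}} (c : Cost n) (triangle : Triangle c) {tsp} (optimal : IsTSPOpt c tsp) where
  open ℚ.≤-Reasoning

  tsp≤cycleCost : ∀ {L} → Unique L → (∀ t → t ∈ L) → tsp ≤ cycleCost c L
  tsp≤cycleCost {L} unique complete with tabulatingPermutation unique complete
  ... | π , tabulate≡L = begin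
    tsp                               ≤⟨ proj₂ optimal π ⟩
    tourCost c π                      ≡⟨ tourCost≡cycleCost c π ⟩
    cycleCost c (tabulate (π ⟨$⟩ʳ_))  ≡⟨ cong (cycleCost c) tabulate≡L ⟩
    cycleCost c L                     ∎

  tsp≤consecVisits : ∀ {v d i j} → ConsecVisits v d i j → (∀ t → t ≡ d ⊎ VisitedIn v (suc i) j t) →
                     tsp ≤ pathCost c v i (j ∸ i)
  tsp≤consecVisits {v} {d} {i} (i<j , vi≡d , vj≡d , gap) visitsAll with ℕ.m≤n⇒∃[o]m+o≡n i<j
  ... | m , refl = begin
    tsp                                  ≤⟨ tsp≤cycleCost (d∉zs ∷ UniqueDec.deduplicate-! _≟ᶠ_ ys) complete ⟩
    walkCost c d (zs ++ [ d ])           ≤⟨ walkCost-shortcut c triangle d d (deduplicate-⊆ _≟ᶠ_ ys) ⟩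
    walkCost c d (ys ++ [ d ])           ≡⟨ cong₂ (λ x xs → walkCost c x xs) (sym vi≡d) (sym trace≡) ⟩
    walkCost c (v i) (trace v i (suc m)) ≡⟨ sym (pathCost≡walkCost c v i (suc m)) ⟩
    pathCost c v i (suc m)               ≡⟨ cong (pathCost c v i) (sym gap≡) ⟩
    pathCost c v i (suc i +ℕ m ∸ i)      ∎
    where
      ys zs : List (Fin n)
      ys = trace v i m
      zs = deduplicate _≟ᶠ_ ys
      d∉zs : All.All (d ≢_) zs
      d∉zs = ¬Any⇒All¬ zs λ d∈zs →
        let (p , p<j , i<p , vp≡d) = ∈-trace⁻ v i m (∈-deduplicate⁻ _≟ᶠ_ ys d∈zs) in gap p i<p p<j vp≡d
      complete : ∀ t → t ∈ d ∷ zs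
      complete t with visitsAll t
      ... | inj₁ t≡d    = here t≡d
      ... | inj₂ visited = there (∈-deduplicate⁺ _≟ᶠ_ (∈-trace⁺ v i m visited))
      trace≡ : trace v i (suc m) ≡ ys ++ [ d ]
      trace≡ = trans (trace-∷ʳ v i m) (cong (λ x → ys ++ [ x ]) vj≡d)
      gap≡ : suc i +ℕ m ∸ i ≡ suc m
      gap≡ = trans (ℕ.+-∸-assoc 1 (ℕ.m≤m+n i m)) (cong suc (ℕ.m+n∸m≡n i m))

  tsp≤revisitTime : ∀ {k} .{{_ : NonZero k}} (w : Fin k → Fin n) → (∀ t → ∃ λ x → w x ≡ t) →
                    ∀ {r} → IsRevisitTime c w r → tsp ≤ r
  tsp≤revisitTime {k} w onto (_ , maximal)
    with returnVisitingAll (ext w) k (k +ℕ k) (ext-visitsAll w onto)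
           (VisitedIn-shift (ext w) (ext-periodic w) ∘ ext-visitsAll w onto)
  ... | d , i , j , consec , visitsAll =
    ℚ.≤-trans (tsp≤consecVisits consec visitsAll) (maximal d i j consec)

m<n⇒m≢[1+m]%n : ∀ {m n} .{{_ : NonZero n}} → 2 ≤ℕ n → m <ℕ n → m ≢ suc m % n
m<n⇒m≢[1+m]%n {m} 2≤n m<n m≡[1+m]%n with ℕ.m≤n⇒m<n∨m≡n m<n
... | inj₁ 1+m<n = ℕ.1+n≢n (sym (trans m≡[1+m]%n (m<n⇒m%n≡m 1+m<n)))
... | inj₂ refl  = ℕ.<⇒≢ (s≤s⁻¹ 2≤n) (sym (trans m≡[1+m]%n (n%n≡0 (suc m))))

module _ {n} {{_ : NonZero n}} (c : Cost n) (π : Permutation′ n) where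
  private
    w : Fin n → Fin n
    w = π ⟨$⟩ʳ_

    v : ℕ → Fin n
    v = ext w

    injective : ∀ {x y} → w x ≡ w y → x ≡ y
    injective = Injection.injective (↔⇒↣ π)

    0<n : 0 <ℕ n
    0<n = >-nonZero⁻¹ n

  tourWalk-isClosedWalk : 2 ≤ℕ n → IsClosedWalk w
  tourWalk-isClosedWalk 2≤n =
    (λ x vx≡vx+1 → m<n⇒m≢[1+m]%n 2≤n (toℕ<n x)
                     (trans (sym (m<n⇒m%n≡m (toℕ<n x))) (ext-injective-mod w injective vx≡vx+1))) ,
    λ t → π ⟨$⟩ˡ t , inverseʳ π

  tourWalk-revisitTime : (∀ x y → 0ℚ ≤ c x y) → IsRevisitTime c w (tourCost c π)
  tourWalk-revisitTime nonneg =
    (v 0 , 0 , n , (0<n , refl , ext-periodic w 0 , noReturn) , refl) ,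
    λ d i j consec → ℚ.≤-trans
      (pathCost-monoˡ c nonneg v i (consecVisits-gap≤period v 0<n (ext-periodic w) consec))
      (ℚ.≤-reflexive (pathCost-rotate c (ext-periodic w) i))
    where
      noReturn : ∀ l → 0 <ℕ l → l <ℕ n → v l ≢ v 0
      noReturn l 0<l l<n vl≡v0 = ℕ.<⇒≢ 0<l (sym (begin
        l       ≡⟨ sym (m<n⇒m%n≡m l<n) ⟩
        l % n   ≡⟨ ext-injective-mod w injective vl≡v0 ⟩
        0 % n   ≡⟨ m<n⇒m%n≡m 0<n ⟩
        0       ∎))
        where open ≡-Reasoning

nonneg-cost : ∀ {n} {c : Cost n} → (∀ u v → u ≢ v → 0ℚ < c u v) → (∀ u → c u u ≡ 0ℚ) →
              ∀ u v → 0ℚ ≤ c u v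
nonneg-cost pos diagonal u v with u ≟ᶠ v
... | yes refl = ℚ.≤-reflexive (sym (diagonal u))
... | no u≢v   = ℚ.<⇒≤ (pos u v u≢v)

lemma2 : (n : ℕ) → 2 ≤ℕ n → (c : Cost n) →
         (∀ u v → u ≢ v → 0ℚ < c u v) → (∀ u → c u u ≡ 0ℚ) →
         (∀ u v w → c u w ≤ c u v + c v w) →
         (tsp : ℚ) → IsTSPOpt c tsp →
         IsRStar c n tsp × (∀ k → n ≤ℕ k → ∀ r → IsRStar c k r → tsp ≤ r)
lemma2 zero    ()
lemma2 (suc _) 2≤n c pos diagonal triangle tsp optimal with proj₁ optimal
... | π , tour≡tsp =
  ( (π ⟨$⟩ʳ_ , tourWalk-isClosedWalk c π 2≤n ,
     subst (IsRevisitTime c (π ⟨$⟩ʳ_)) tour≡tsp (tourWalk-revisitTime c π (nonneg-cost pos diagonal)))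
  , λ w closed _ → tsp≤revisitTime c triangle optimal w (proj₂ closed) )
  , λ { (suc k) _ r rStar → let (w , closed , revisit) = proj₁ rStar
                             in tsp≤revisitTime c triangle optimal w (proj₂ closed) revisit }
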